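{- Let $T$ be a tournament on $n$ vertices, $U\subseteq V(T)$, and $c\in\mathbb{N}$ with $c\ge 2$. Suppose $\delta^-(T)\ge 2^{c+1}+c|U|$. Then there exist families $\{A_v:v\in U\}$ and $\{E_v:v\in U\}$ of subsets of $V(T)$ such that: (i) $A_v$ out-dominates $V(T)\setminus(E_v\cup\bigcup_{u\in U}A_u)$ for all $v\in U$; (ii) $T[A_v]$ is a transitive tournament with head $v$ for all $v\in U$; (iii) $|E_v|\le (1/2)^{c-1}d^-(v)$ for all $v\in U$; (iv) $2\le|A_v|\le c$ for all $v\in U$; (v) $A_u\cap E_v=\emptyset$ for all $u,v\in U$; (vi) $A_u\cap A_v=\emptyset$ for all $u\ne v$.
   Context: $\delta^-(T)$ is the minimum in-degree of $T$ and $d^-(v)$ the in-degree of $v$. A tournament is transitive if its vertices can be ordered $v_1,\dots,v_m$ with $v_iv_j$ an edge iff $i<j$; $v_m$ is its head. $A$ out-dominates $Z$ if every vertex of $Z$ is an out-neighbour of some vertex of $A$. -}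

module Defs where

open import Data.Nat using (ℕ; suc; _≤_; _*_; _+_; _^_; _∸_)
open import Data.Fin using (Fin; fromℕ; _<_)
open import Data.Fin.Subset using (Subset; _∈_; _∉_; ∣_∣)
open import Data.Bool using (Bool; true; false; not)
open import Data.Vec using (tabulate)
open import Data.Product using (Σ; ∃; _×_; _,_)
open import Relation.Binary.PropositionalEquality using (_≡_; _≢_)
open import Relation.Nullary using (¬_)
open import Function.Bundles using (_⇔_)

-- A tournament on vertex set Fin n: adjacency adj u v ≡ true means the edge u → v.
-- Loopless, and for distinct u,v exactly one of u→v, v→u.
record Tournament (n : ℕ) : Set where
  field
    adj       : Fin n → Fin n → Bool
    loopless  : ∀ v → adj v v ≡ false
    oriented  : ∀ u v → u ≢ v → adj u v ≡ not (adj v u)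
open Tournament public

Edge : ∀ {n} → Tournament n → Fin n → Fin n → Set
Edge T u v = adj T u v ≡ true

inNbhd : ∀ {n} → Tournament n → Fin n → Subset n
inNbhd T v = tabulate (λ u → adj T u v)

indeg : ∀ {n} → Tournament n → Fin n → ℕ
indeg T v = ∣ inNbhd T v ∣

minIndeg≥ : ∀ {n} → Tournament n → ℕ → Set
minIndeg≥ T k = ∀ v → k ≤ indeg T v

OutDominates : ∀ {n} → Tournament n → Subset n → (Fin n → Set) → Set
OutDominates T A Z = ∀ z → Z z → ∃ λ a → a ∈ A × Edge T a z

TransitiveWithHead : ∀ {n} → Tournament n → Subset n → Fin n → Set
TransitiveWithHead {n} T A v =
  Σ ℕ λ m → Σ (Fin (suc m) → Fin n) λ w →
    (∀ x → x ∈ A ⇔ (∃ λ i → w i ≡ x)) ×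
    (∀ i j → Edge T (w i) (w j) ⇔ i < j) ×
    w (fromℕ m) ≡ v

module Submission where

-- Each v ∈ U receives a transitive tournament A_v with head v, grown backwards from v: keep the set R
-- of vertices outside a forbidden set F that beat every vertex of the chain built so far, and prepend a
-- vertex of R with at most |R|/2 in-neighbours inside R (one exists because R spans at most |R|²/2
-- arcs).  Each step at least halves R, so after c − 1 steps, or earlier once R is empty,
-- 2^(c−1)|R| ≤ d⁻(v), and R serves as E_v: a vertex outside A_v, F and R fails to beat some chain
-- vertex, which therefore beats it.  The vertices of U are processed in turn with F the union of the
-- other A_u; since |F| ≤ c|U| < d⁻(v), R is nonempty at the start, so |A_v| ≥ 2, and the A_v come out
-- disjoint.  Finally the vertices of the A_u chosen later are removed from E_v.

open import Defs
open import Data.Bool as Bool using (Bool; true; false; not; _∧_; _∨_)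
import Data.Bool.Properties as Boolₚ
open import Data.Fin as Fin using (Fin; zero; suc; toℕ; fromℕ; fromℕ<)
open import Data.Fin.Properties as Finₚ using (any?; all?; ¬∀⟶∃¬)
open import Data.Fin.Subset using (Subset; _∈_; _∉_; ∣_∣)
open import Data.Fin.Subset.Properties using (_∈?_)
open import Data.Nat using (ℕ; zero; suc; z≤n; s≤s; s≤s⁻¹; _≤_; _<_; _<?_; _+_; _*_; _^_; _∸_; >-nonZero)
open import Data.Nat.Properties
open import Algebra.Properties.CommutativeMonoid.Sum +-0-commutativeMonoid
  using (sum; sum-syntax; ∑-distrib-+; ∑-comm; sum-cong-≗; sum-replicate-zero)
open import Algebra.Properties.Semiring.Sum +-*-semiring using (*-distribˡ-sum; *-distribʳ-sum)
open import Data.Product using (Σ; ∃; _×_; _,_; proj₁; proj₂)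
open import Data.Sum using (_⊎_; inj₁; inj₂)
open import Data.Vec using (tabulate; lookup)
import Data.Vec.Properties as Vecₚ
open import Data.Vec.Functional using (_∷_; updateAt)
open import Data.Vec.Functional.Properties using (updateAt-updates; updateAt-minimal)
open import Function.Bundles using (_⇔_; mk⇔; Equivalence)
open import Relation.Binary.PropositionalEquality
  using (_≡_; _≢_; refl; sym; trans; cong; cong₂; subst; subst₂; module ≡-Reasoning)
open import Relation.Nullary using (¬_; yes; no; does; contradiction)
open import Relation.Nullary.Decidable using (dec-true; dec-false; _→-dec_)

true⇒¬false : ∀ {b} → b ≡ true → ¬ (b ≡ false)
true⇒¬false refl ()

∧-≡true : ∀ {a b} → a ≡ true → b ≡ true → a ∧ b ≡ true
∧-≡true refl refl = refl

𝟙 : Bool → ℕ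
𝟙 true  = 1
𝟙 false = 0

count : ∀ {n} → (Fin n → Bool) → ℕ
count {n} P = ∑[ i < n ] 𝟙 (P i)

_⊆ᵇ_ : ∀ {n} → (Fin n → Bool) → (Fin n → Bool) → Set
P ⊆ᵇ Q = ∀ i → P i ≡ true → Q i ≡ true

sum-mono-≤ : ∀ {n} {f g : Fin n → ℕ} → (∀ i → f i ≤ g i) → sum f ≤ sum g
sum-mono-≤ {zero}  f≤g = z≤n
sum-mono-≤ {suc n} f≤g = +-mono-≤ (f≤g zero) (sum-mono-≤ (λ i → f≤g (suc i)))

count-mono : ∀ {n} {P Q : Fin n → Bool} → P ⊆ᵇ Q → count P ≤ count Q
count-mono {P = P} {Q} P⊆Q = sum-mono-≤ 𝟙-mono
  where
  𝟙-mono : ∀ i → 𝟙 (P i) ≤ 𝟙 (Q i)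
  𝟙-mono i with P i | P⊆Q i
  ... | false | _   = z≤n
  ... | true  | P→Q rewrite P→Q refl = ≤-refl

count-≤-+ : ∀ {n} {P Q R : Fin n → Bool} →
  (∀ i → P i ≡ true → Q i ≡ true ⊎ R i ≡ true) → count P ≤ count Q + count R
count-≤-+ {n} {P} {Q} {R} P⊆Q∪R = begin
  count P                       ≤⟨ sum-mono-≤ 𝟙-≤ ⟩
  ∑[ i < n ] (𝟙 (Q i) + 𝟙 (R i)) ≡⟨ ∑-distrib-+ (λ i → 𝟙 (Q i)) (λ i → 𝟙 (R i)) ⟩
  count Q + count R             ∎
  where
  open ≤-Reasoning
  𝟙-≤ : ∀ i → 𝟙 (P i) ≤ 𝟙 (Q i) + 𝟙 (R i)
  𝟙-≤ i with P i | P⊆Q∪R i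
  ... | false | _ = z≤n
  ... | true  | P→Q∪R with P→Q∪R refl
  ...   | inj₁ Qi rewrite Qi = s≤s z≤n
  ...   | inj₂ Ri rewrite Ri = m≤n+m 1 (𝟙 (Q i))

count-∅ : ∀ {n} → count {n} (λ _ → false) ≡ 0
count-∅ {n} = sum-replicate-zero n

∧-count : ∀ {n} b (P : Fin n → Bool) → count (λ i → b ∧ P i) ≡ 𝟙 b * count P
∧-count {n} false P = count-∅ {n}
∧-count true  P = sym (+-identityʳ (count P))

insert : ∀ {n} → Fin n → (Fin n → Bool) → Fin n → Bool
insert x P y = does (y Fin.≟ x) ∨ P y

⁅_⁆ : ∀ {n} → Fin n → Fin n → Bool
⁅ x ⁆ = insert x (λ _ → false)

count-insert : ∀ {n} x (P : Fin n → Bool) → P x ≡ false → count (insert x P) ≡ suc (count P)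
count-insert {suc n} zero    P P0≡false rewrite P0≡false =
  cong suc (sum-cong-≗ (λ i → cong (λ b → 𝟙 (b ∨ P (suc i))) (dec-false (suc i Fin.≟ zero) λ ())))
count-insert {suc n} (suc x) P Px≡false = begin
  𝟙 (does (zero Fin.≟ suc x) ∨ P zero) + count (insert x (λ i → P (suc i)))
    ≡⟨ cong₂ _+_ (cong (λ b → 𝟙 (b ∨ P zero)) (dec-false (zero Fin.≟ suc x) λ ()))
                 (count-insert x (λ i → P (suc i)) Px≡false) ⟩
  𝟙 (P zero) + suc (count (λ i → P (suc i)))  ≡⟨ +-suc (𝟙 (P zero)) _ ⟩
  suc (count P) ∎
  where
  open ≡-Reasoning

count-⁅⁆ : ∀ {n} (x : Fin n) → count ⁅ x ⁆ ≡ 1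
count-⁅⁆ {n} x = trans (count-insert x (λ _ → false) refl) (cong suc (count-∅ {n}))

∈-insert⁺ˡ : ∀ {n} x (P : Fin n → Bool) → insert x P x ≡ true
∈-insert⁺ˡ x P rewrite dec-true (x Fin.≟ x) refl = refl

∈-insert⁺ʳ : ∀ {n} x {P : Fin n → Bool} {y} → P y ≡ true → insert x P y ≡ true
∈-insert⁺ʳ x {y = y} Py rewrite Py = Boolₚ.∨-zeroʳ (does (y Fin.≟ x))

∈-insert⁻ : ∀ {n} x (P : Fin n → Bool) {y} → insert x P y ≡ true → y ≡ x ⊎ P y ≡ true
∈-insert⁻ x P {y} e with y Fin.≟ x
... | yes y≡x = inj₁ y≡x
... | no  _   = inj₂ e

∈⁅⁆⁻ : ∀ {n} {x y : Fin n} → ⁅ x ⁆ y ≡ true → y ≡ x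
∈⁅⁆⁻ {x = x} {y} y∈ with ∈-insert⁻ x (λ _ → false) {y} y∈
... | inj₁ y≡x = y≡x

count-pos : ∀ {n} {P : Fin n → Bool} x → P x ≡ true → 1 ≤ count P
count-pos {P = P} x Px = subst (_≤ count P) (count-⁅⁆ x) (count-mono ⁅x⁆⊆P)
  where
  ⁅x⁆⊆P : ⁅ x ⁆ ⊆ᵇ P
  ⁅x⁆⊆P y y∈ = subst (λ y → P y ≡ true) (sym (∈⁅⁆⁻ y∈)) Px

⋃ : ∀ {m n} → (Fin m → Bool) → (Fin m → Fin n → Bool) → Fin n → Bool
⋃ W S x = does (any? λ u → W u ∧ S u x Bool.≟ true)

∈⋃⁺ : ∀ {m n} {W : Fin m → Bool} {S : Fin m → Fin n → Bool} {u x} →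
  W u ≡ true → S u x ≡ true → ⋃ W S x ≡ true
∈⋃⁺ {u = u} Wu Sux = dec-true (any? _) (u , ∧-≡true Wu Sux)

∈⋃⁻ : ∀ {m n} {W : Fin m → Bool} {S : Fin m → Fin n → Bool} {x} →
  ⋃ W S x ≡ true → ∃ λ u → W u ≡ true × S u x ≡ true
∈⋃⁻ {W = W} {S} {x} e with any? (λ u → W u ∧ S u x Bool.≟ true)
... | yes (u , WuSux) = u , Boolₚ.∧-conicalˡ _ _ WuSux , Boolₚ.∧-conicalʳ _ _ WuSux

count-⋃≤ : ∀ {m n} {W : Fin m → Bool} {S : Fin m → Fin n → Bool} c →
  (∀ u → W u ≡ true → count (S u) ≤ c) → count (⋃ W S) ≤ c * count W
count-⋃≤ {m} {n} {W} {S} c ∣S∣≤c = begin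
  count (⋃ W S)                               ≤⟨ sum-mono-≤ 𝟙-⋃ ⟩
  ∑[ x < n ] ∑[ u < m ] 𝟙 (W u ∧ S u x)         ≡⟨ ∑-comm (λ x u → 𝟙 (W u ∧ S u x)) ⟩
  ∑[ u < m ] count (λ x → W u ∧ S u x)        ≡⟨ sum-cong-≗ (λ u → ∧-count (W u) (S u)) ⟩
  ∑[ u < m ] (𝟙 (W u) * count (S u))          ≤⟨ sum-mono-≤ 𝟙*∣S∣≤ ⟩
  ∑[ u < m ] (c * 𝟙 (W u))                    ≡⟨ sym (*-distribˡ-sum c (λ u → 𝟙 (W u))) ⟩
  c * count W                                 ∎
  where
  open ≤-Reasoning
  𝟙-⋃ : ∀ x → 𝟙 (⋃ W S x) ≤ count (λ u → W u ∧ S u x)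
  𝟙-⋃ x with ⋃ W S x in e
  ... | false = z≤n
  ... | true  = let (u , Wu , Sux) = ∈⋃⁻ {W = W} {S} e in count-pos u (∧-≡true Wu Sux)
  𝟙*∣S∣≤ : ∀ u → 𝟙 (W u) * count (S u) ≤ c * 𝟙 (W u)
  𝟙*∣S∣≤ u with W u in Wu
  ... | false = z≤n
  ... | true  = subst₂ _≤_ (sym (+-identityʳ _)) (sym (*-identityʳ c)) (∣S∣≤c u Wu)

∣tabulate∣ : ∀ {n} (P : Fin n → Bool) → ∣ tabulate P ∣ ≡ count P
∣tabulate∣ {zero}  P = refl
∣tabulate∣ {suc n} P with P zero
... | true  = cong suc (∣tabulate∣ (λ i → P (suc i)))
... | false = ∣tabulate∣ (λ i → P (suc i))

∈-tabulate⁻ : ∀ {n} {P : Fin n → Bool} {x} → x ∈ tabulate P → P x ≡ true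
∈-tabulate⁻ {P = P} {x} x∈ = trans (sym (Vecₚ.lookup∘tabulate P x)) (Vecₚ.[]=⇒lookup x∈)

∈-tabulate⁺ : ∀ {n} {P : Fin n → Bool} {x} → P x ≡ true → x ∈ tabulate P
∈-tabulate⁺ {P = P} {x} Px = Vecₚ.lookup⇒[]= x _ (trans (Vecₚ.lookup∘tabulate P x) Px)

∉-tabulate⁻ : ∀ {n} {P : Fin n → Bool} {x} → x ∉ tabulate P → P x ≡ false
∉-tabulate⁻ x∉ = Boolₚ.¬-not λ Px → x∉ (∈-tabulate⁺ Px)

∣p∣≡count : ∀ {n} (p : Subset n) → ∣ p ∣ ≡ count (lookup p)
∣p∣≡count p = trans (cong ∣_∣ (sym (Vecₚ.tabulate∘lookup p))) (∣tabulate∣ (lookup p))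

indeg≡count : ∀ {n} (T : Tournament n) v → indeg T v ≡ count (λ u → adj T u v)
indeg≡count T v = ∣tabulate∣ (λ u → adj T u v)

edge-asym : ∀ {n} (T : Tournament n) {u w} → Edge T u w → adj T w u ≡ false
edge-asym T {u} {w} uw with u Fin.≟ w
... | yes refl = contradiction (loopless T u) (true⇒¬false uw)
... | no u≢w rewrite oriented T w u (λ w≡u → u≢w (sym w≡u)) | uw = refl

non-edge-flip : ∀ {n} (T : Tournament n) {u w} → u ≢ w → adj T u w ≡ false → Edge T w u
non-edge-flip T {u} {w} u≢w ¬uw rewrite oriented T w u (λ w≡u → u≢w (sym w≡u)) | ¬uw = refl

indegIn : ∀ {n} → Tournament n → (Fin n → Bool) → Fin n → ℕ
indegIn T R w = count (λ u → R u ∧ adj T u w)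

arcsWithin : ∀ {n} → Tournament n → (Fin n → Bool) → ℕ
arcsWithin {n} T R = ∑[ w < n ] (𝟙 (R w) * indegIn T R w)

adj-antisym : ∀ {n} (T : Tournament n) u w → 𝟙 (adj T u w) + 𝟙 (adj T w u) ≤ 1
adj-antisym T u w with u Fin.≟ w
... | yes refl rewrite loopless T u = z≤n
... | no u≢w rewrite oriented T u w u≢w with adj T w u
...   | true  = ≤-refl
...   | false = ≤-refl

2*arcsWithin≤ : ∀ {n} (T : Tournament n) (R : Fin n → Bool) → 2 * arcsWithin T R ≤ count R * count R
2*arcsWithin≤ {n} T R = begin
  2 * S
    ≡⟨ cong (S +_) (+-identityʳ S) ⟩
  S + S
    ≡⟨ cong₂ _+_ arcs≡ (trans arcs≡ (∑-comm (λ w u → a u w))) ⟩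
  ∑[ w < n ] ∑[ u < n ] a u w + ∑[ w < n ] ∑[ u < n ] a w u
    ≡⟨ sym (∑-distrib-+ (λ w → ∑[ u < n ] a u w) (λ w → ∑[ u < n ] a w u)) ⟩
  ∑[ w < n ] (∑[ u < n ] a u w + ∑[ u < n ] a w u)
    ≡⟨ sum-cong-≗ (λ w → sym (∑-distrib-+ (λ u → a u w) (λ u → a w u))) ⟩
  ∑[ w < n ] ∑[ u < n ] (a u w + a w u)
    ≤⟨ sum-mono-≤ (λ w → sum-mono-≤ (λ u → pair≤ u w)) ⟩
  ∑[ w < n ] ∑[ u < n ] (𝟙 (R u) * 𝟙 (R w))
    ≡⟨ sum-cong-≗ (λ w → sym (*-distribʳ-sum (𝟙 (R w)) (λ u → 𝟙 (R u)))) ⟩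
  ∑[ w < n ] (count R * 𝟙 (R w))
    ≡⟨ sym (*-distribˡ-sum (count R) (λ w → 𝟙 (R w))) ⟩
  count R * count R
    ∎
  where
  open ≤-Reasoning
  S : ℕ
  S = arcsWithin T R
  a : Fin n → Fin n → ℕ
  a u w = 𝟙 (R w ∧ (R u ∧ adj T u w))
  arcs≡ : S ≡ ∑[ w < n ] ∑[ u < n ] a u w
  arcs≡ = sum-cong-≗ (λ w → sym (∧-count (R w) (λ u → R u ∧ adj T u w)))
  pair≤ : ∀ u w → a u w + a w u ≤ 𝟙 (R u) * 𝟙 (R w)
  pair≤ u w with R u | R w
  ... | true  | true  = adj-antisym T u w
  ... | true  | false = z≤n
  ... | false | true  = z≤n
  ... | false | false = z≤n

¬∀-indegIn>half : ∀ {n} (T : Tournament n) (R : Fin n → Bool) → 1 ≤ count R →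
  ¬ (∀ w → R w ≡ true → count R < 2 * indegIn T R w)
¬∀-indegIn>half {n} T R R≢∅ large = <⇒≱ (*-monoʳ-< (count R) {{>-nonZero R≢∅}} (n<1+n (count R))) (begin
  count R * suc (count R)                    ≡⟨ *-distribʳ-sum (suc (count R)) (λ w → 𝟙 (R w)) ⟩
  ∑[ w < n ] (𝟙 (R w) * suc (count R))       ≤⟨ sum-mono-≤ bound ⟩
  ∑[ w < n ] (2 * (𝟙 (R w) * indegIn T R w)) ≡⟨ sym (*-distribˡ-sum 2 (λ w → 𝟙 (R w) * indegIn T R w)) ⟩
  2 * arcsWithin T R                         ≤⟨ 2*arcsWithin≤ T R ⟩
  count R * count R                          ∎)
  where
  open ≤-Reasoning
  bound : ∀ w → 𝟙 (R w) * suc (count R) ≤ 2 * (𝟙 (R w) * indegIn T R w)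
  bound w with R w | large w
  ... | false | _ = z≤n
  ... | true  | R<2d =
    subst₂ _≤_ (sym (+-identityʳ (suc (count R))))
               (cong (2 *_) (sym (+-identityʳ (indegIn T R w)))) (R<2d refl)

∃-indegIn-≤-half : ∀ {n} (T : Tournament n) (R : Fin n → Bool) → 1 ≤ count R →
  ∃ λ w → R w ≡ true × 2 * indegIn T R w ≤ count R
∃-indegIn-≤-half {n} T R R≢∅
  with ¬∀⟶∃¬ n _ (λ w → R w Bool.≟ true →-dec count R <? 2 * indegIn T R w) (¬∀-indegIn>half T R R≢∅)
... | w , small with R w in Rw
...   | false = contradiction (λ ()) small
...   | true  = w , Rw , ≮⇒≥ λ R<2d → small λ _ → R<2d

TransitiveWithHeadᵇ : ∀ {n} → Tournament n → (Fin n → Bool) → Fin n → Set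
TransitiveWithHeadᵇ {n} T A v =
  Σ ℕ λ m → Σ (Fin (suc m) → Fin n) λ w →
    (∀ x → A x ≡ true ⇔ (∃ λ i → w i ≡ x)) ×
    (∀ i j → Edge T (w i) (w j) ⇔ i Fin.< j) ×
    w (fromℕ m) ≡ v

transitive⇒head∈ : ∀ {n} {T : Tournament n} {A v} → TransitiveWithHeadᵇ T A v → A v ≡ true
transitive⇒head∈ (m , w , A⇔ , _ , head) = Equivalence.from (A⇔ _) (fromℕ m , head)

transitiveWithHead-tabulate : ∀ {n} {T : Tournament n} {A v} →
  TransitiveWithHeadᵇ T A v → TransitiveWithHead T (tabulate A) v
transitiveWithHead-tabulate (m , w , A⇔ , arcs , head) =
  m , w , (λ x → mk⇔ (λ x∈A → Equivalence.to (A⇔ x) (∈-tabulate⁻ x∈A))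
                     (λ x∈w → ∈-tabulate⁺ (Equivalence.from (A⇔ x) x∈w))) , arcs , head

arcs-∷ : ∀ {n m} (T : Tournament n) {x} {w : Fin (suc m) → Fin n} →
  (∀ i j → Edge T (w i) (w j) ⇔ i Fin.< j) → (∀ i → Edge T x (w i)) →
  ∀ i j → Edge T ((x ∷ w) i) ((x ∷ w) j) ⇔ i Fin.< j
arcs-∷ T {x} arcs x→w zero    zero    = mk⇔ (λ xx → contradiction (loopless T x) (true⇒¬false xx)) λ ()
arcs-∷ T     arcs x→w zero    (suc j) = mk⇔ (λ _ → s≤s z≤n) (λ _ → x→w j)
arcs-∷ T     arcs x→w (suc i) zero    =
  mk⇔ (λ wx → contradiction (edge-asym T (x→w i)) (true⇒¬false wx)) λ ()
arcs-∷ T     arcs x→w (suc i) (suc j) =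
  mk⇔ (λ e → s≤s (Equivalence.to (arcs i j) e)) (λ i<j → Equivalence.from (arcs i j) (s≤s⁻¹ i<j))

record Chain {n} (T : Tournament n) (F : Fin n → Bool) (v : Fin n) (len : ℕ) : Set where
  field
    vertex        : Fin (suc len) → Fin n
    head          : vertex (fromℕ len) ≡ v
    arcs          : ∀ i j → Edge T (vertex i) (vertex j) ⇔ i Fin.< j
    members       : Fin n → Bool
    members⇔      : ∀ y → members y ≡ true ⇔ (∃ λ i → vertex i ≡ y)
    count-members : count members ≡ suc len
    avoids        : ∀ y → members y ≡ true → F y ≡ false
    candidates    : Fin n → Bool
    candidates⇔   : ∀ z → candidates z ≡ true ⇔ (F z ≡ false × ∀ i → Edge T z (vertex i))
    candidates≤   : 2 ^ len * count candidates ≤ indeg T v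

  transitive : TransitiveWithHeadᵇ T members v
  transitive = len , vertex , members⇔ , arcs , head

  dominates : ∀ z → members z ≡ false → F z ≡ false → candidates z ≡ false →
    ∃ λ a → members a ≡ true × Edge T a z
  dominates z z∉members z∉F z∉candidates
    with all? (λ i → adj T z (vertex i) Bool.≟ true)
  ... | yes z→all = contradiction z∉candidates (true⇒¬false (Equivalence.from (candidates⇔ z) (z∉F , z→all)))
  ... | no ¬z→all with ¬∀⟶∃¬ _ _ (λ i → adj T z (vertex i) Bool.≟ true) ¬z→all
  ...   | i , ¬z→wᵢ = vertex i , wᵢ∈members , non-edge-flip T z≢wᵢ (Boolₚ.¬-not ¬z→wᵢ)
    where
    wᵢ∈members : members (vertex i) ≡ true
    wᵢ∈members = Equivalence.from (members⇔ (vertex i)) (i , refl)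
    z≢wᵢ : z ≢ vertex i
    z≢wᵢ refl = true⇒¬false wᵢ∈members z∉members

module _ {n} {T : Tournament n} {F : Fin n → Bool} {v : Fin n} where

  singletonChain : F v ≡ false → Chain T F v 0
  singletonChain v∉F = record
    { vertex        = λ _ → v
    ; head          = refl
    ; arcs          = λ { zero zero → mk⇔ (λ vv → contradiction (loopless T v) (true⇒¬false vv)) λ () }
    ; members       = ⁅ v ⁆
    ; members⇔      = λ y → mk⇔ (λ y∈ → zero , sym (∈⁅⁆⁻ y∈)) λ { (zero , refl) → ∈-insert⁺ˡ v _ }
    ; count-members = count-⁅⁆ v
    ; avoids        = λ y y∈ → subst (λ y → F y ≡ false) (sym (∈⁅⁆⁻ y∈)) v∉F
    ; candidates    = λ z → not (F z) ∧ adj T z v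
    ; candidates⇔   = λ z → mk⇔ (candidate⁻ z) (λ (z∉F , z→v) → candidate⁺ z∉F (z→v zero))
    ; candidates≤   = begin
        count (λ z → not (F z) ∧ adj T z v) + 0 ≡⟨ +-identityʳ _ ⟩
        count (λ z → not (F z) ∧ adj T z v)     ≤⟨ count-mono (λ z → Boolₚ.∧-conicalʳ (not (F z)) _) ⟩
        count (λ z → adj T z v)                 ≡⟨ sym (indeg≡count T v) ⟩
        indeg T v                               ∎
    }
    where
    open ≤-Reasoning
    candidate⁻ : ∀ z → not (F z) ∧ adj T z v ≡ true → F z ≡ false × (∀ (i : Fin 1) → Edge T z v)
    candidate⁻ z e with F z | adj T z v
    ... | false | true = refl , λ _ → refl
    candidate⁺ : ∀ {z} → F z ≡ false → Edge T z v → not (F z) ∧ adj T z v ≡ true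
    candidate⁺ z∉F z→v rewrite z∉F | z→v = refl

  extendChain : ∀ {len} (C : Chain T F v len) (x : Fin n) → Chain.candidates C x ≡ true →
    2 * indegIn T (Chain.candidates C) x ≤ count (Chain.candidates C) → Chain T F v (suc len)
  extendChain {len} C x x∈R halving = record
    { vertex        = x ∷ vertex
    ; head          = head
    ; arcs          = arcs-∷ T arcs x→chain
    ; members       = insert x members
    ; members⇔      = members⇔′
    ; count-members = trans (count-insert x members x∉members) (cong suc count-members)
    ; avoids        = avoids′
    ; candidates    = λ z → candidates z ∧ adj T z x
    ; candidates⇔   = candidates⇔′
    ; candidates≤   = begin
        2 * 2 ^ len * count R′   ≡⟨ cong (_* count R′) (*-comm 2 (2 ^ len)) ⟩
        2 ^ len * 2 * count R′   ≡⟨ *-assoc (2 ^ len) 2 (count R′) ⟩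
        2 ^ len * (2 * count R′) ≤⟨ *-monoʳ-≤ (2 ^ len) halving ⟩
        2 ^ len * count candidates ≤⟨ candidates≤ ⟩
        indeg T v                  ∎
    }
    where
    open Chain C
    open ≤-Reasoning
    R′ : Fin n → Bool
    R′ z = candidates z ∧ adj T z x
    x∉F×x→chain : F x ≡ false × ∀ i → Edge T x (vertex i)
    x∉F×x→chain = Equivalence.to (candidates⇔ x) x∈R
    x→chain : ∀ i → Edge T x (vertex i)
    x→chain = proj₂ x∉F×x→chain
    x∉members : members x ≡ false
    x∉members = Boolₚ.¬-not λ x∈ → let (i , wᵢ≡x) = Equivalence.to (members⇔ x) x∈ in
      true⇒¬false (x→chain i) (subst (λ y → adj T x y ≡ false) (sym wᵢ≡x) (loopless T x))
    members⇔′ : ∀ y → insert x members y ≡ true ⇔ (∃ λ i → (x ∷ vertex) i ≡ y)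
    members⇔′ y = mk⇔ to from
      where
      to : insert x members y ≡ true → ∃ λ i → (x ∷ vertex) i ≡ y
      to y∈ with ∈-insert⁻ x members y∈
      ... | inj₁ y≡x = zero , sym y≡x
      ... | inj₂ y∈members = let (i , wᵢ≡y) = Equivalence.to (members⇔ y) y∈members in suc i , wᵢ≡y
      from : (∃ λ i → (x ∷ vertex) i ≡ y) → insert x members y ≡ true
      from (zero  , refl) = ∈-insert⁺ˡ x members
      from (suc i , wᵢ≡y) = ∈-insert⁺ʳ x {members} (Equivalence.from (members⇔ y) (i , wᵢ≡y))
    avoids′ : ∀ y → insert x members y ≡ true → F y ≡ false
    avoids′ y y∈ with ∈-insert⁻ x members y∈
    ... | inj₁ refl       = proj₁ x∉F×x→chain
    ... | inj₂ y∈members = avoids y y∈members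
    candidates⇔′ : ∀ z → R′ z ≡ true ⇔ (F z ≡ false × ∀ i → Edge T z ((x ∷ vertex) i))
    candidates⇔′ z = mk⇔ to from
      where
      to : R′ z ≡ true → F z ≡ false × ∀ i → Edge T z ((x ∷ vertex) i)
      to z∈R′ with Equivalence.to (candidates⇔ z) (Boolₚ.∧-conicalˡ _ _ z∈R′)
      ... | z∉F , z→chain = z∉F , λ { zero → Boolₚ.∧-conicalʳ _ _ z∈R′ ; (suc i) → z→chain i }
      from : F z ≡ false × (∀ i → Edge T z ((x ∷ vertex) i)) → R′ z ≡ true
      from (z∉F , z→chain′)
        rewrite Equivalence.from (candidates⇔ z) (z∉F , λ i → z→chain′ (suc i)) | z→chain′ zero = refl

  singletonChain-candidates≢∅ : (v∉F : F v ≡ false) → count F < indeg T v →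
    1 ≤ count (Chain.candidates (singletonChain v∉F))
  singletonChain-candidates≢∅ v∉F F<d = +-cancelʳ-< (count F) 0 (count R₀) (<-≤-trans F<d d≤R₀+F)
    where
    R₀ : Fin n → Bool
    R₀ = Chain.candidates (singletonChain v∉F)
    R₀∪F : ∀ z → adj T z v ≡ true → R₀ z ≡ true ⊎ F z ≡ true
    R₀∪F z z→v with F z
    ... | true  = inj₂ refl
    ... | false = inj₁ z→v
    d≤R₀+F : indeg T v ≤ count R₀ + count F
    d≤R₀+F = subst (_≤ count R₀ + count F) (sym (indeg≡count T v)) (count-≤-+ R₀∪F)

  growChain : ∀ {len} (C : Chain T F v len) → 1 ≤ count (Chain.candidates C) → Chain T F v (suc len)
  growChain C R≢∅ =
    let (x , x∈R , halving) = ∃-indegIn-≤-half T (Chain.candidates C) R≢∅ in extendChain C x x∈R halving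

  growChainBy : ∀ {len} (k : ℕ) → Chain T F v len →
    Σ ℕ λ len′ → Σ (Chain T F v len′) λ C′ →
      len ≤ len′ × len′ ≤ len + k × 2 ^ (len + k) * count (Chain.candidates C′) ≤ indeg T v
  growChainBy {len} zero C =
    len , C , ≤-refl , m≤m+n len 0 ,
    subst (λ m → 2 ^ m * count (Chain.candidates C) ≤ indeg T v) (sym (+-identityʳ len)) (Chain.candidates≤ C)
  growChainBy {len} (suc k) C with count (Chain.candidates C) in R-size
  ... | zero  = len , C , ≤-refl , m≤m+n len (suc k) ,
                subst (λ r → 2 ^ (len + suc k) * r ≤ indeg T v) (sym R-size)
                      (subst (_≤ indeg T v) (sym (*-zeroʳ (2 ^ (len + suc k)))) z≤n)
  ... | suc _ with growChainBy k (growChain C (subst (1 ≤_) (sym R-size) (s≤s z≤n)))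
  ...   | len′ , C′ , 1+len≤len′ , len′≤ , C′-bound rewrite +-suc len k =
            len′ , C′ , ≤-trans (n≤1+n len) 1+len≤len′ , len′≤ , C′-bound

record Dominator {n} (T : Tournament n) (F : Fin n → Bool) (v : Fin n) (c : ℕ) : Set where
  field
    A E          : Fin n → Bool
    transitive   : TransitiveWithHeadᵇ T A v
    avoids       : ∀ x → A x ≡ true → F x ≡ false
    exceptional≤ : 2 ^ (c ∸ 1) * count E ≤ indeg T v
    2≤∣A∣        : 2 ≤ count A
    ∣A∣≤c        : count A ≤ c
    dominates    : ∀ z → A z ≡ false → F z ≡ false → E z ≡ false → ∃ λ a → A a ≡ true × Edge T a z

dominator : ∀ {n} (T : Tournament n) (F : Fin n → Bool) (v : Fin n) c → 2 ≤ c →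
  F v ≡ false → count F < indeg T v → Dominator T F v c
dominator T F v (suc (suc c′)) (s≤s (s≤s _)) v∉F F<d
  with growChainBy {T = T} c′ (growChain (singletonChain v∉F) (singletonChain-candidates≢∅ {T = T} v∉F F<d))
... | m , C , 1≤m , m≤ , bound = record
  { A            = members
  ; E            = candidates
  ; transitive   = transitive
  ; avoids       = avoids
  ; exceptional≤ = bound
  ; 2≤∣A∣        = subst (2 ≤_) (sym count-members) (s≤s 1≤m)
  ; ∣A∣≤c        = subst (_≤ suc (suc c′)) (sym count-members) (s≤s m≤)
  ; dominates    = dominates
  }
  where open Chain C

module _ {n} (T : Tournament n) (U : Subset n) (c : ℕ) where

  U∖⁅_⁆ : Fin n → Fin n → Bool
  U∖⁅ v ⁆ u = lookup U u ∧ not (does (u Fin.≟ v))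

  others : (Fin n → Fin n → Bool) → Fin n → Fin n → Bool
  others A v = ⋃ U∖⁅ v ⁆ A

  ∈others⁺ : ∀ A {v u x} → u ∈ U → u ≢ v → A u x ≡ true → others A v x ≡ true
  ∈others⁺ A {v} {u} u∈U u≢v Aux = ∈⋃⁺ {W = U∖⁅ v ⁆} {S = A}
    (∧-≡true (Vecₚ.[]=⇒lookup u∈U) (cong not (dec-false (u Fin.≟ v) u≢v))) Aux

  ∈others⁻ : ∀ A {v x} → others A v x ≡ true → ∃ λ u → u ∈ U × u ≢ v × A u x ≡ true
  ∈others⁻ A {v} x∈ with ∈⋃⁻ {W = U∖⁅ v ⁆} {S = A} x∈
  ... | u , u∈U-v , Aux with lookup U u in u∈U | u Fin.≟ v
  ...   | true | no u≢v = u , Vecₚ.lookup⇒[]= u U u∈U , u≢v , Aux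

  count-others≤ : ∀ {A} v → (∀ u → u ∈ U → count (A u) ≤ c) → count (others A v) ≤ c * ∣ U ∣
  count-others≤ {A} v ∣A∣≤c = begin
    count (others A v)   ≤⟨ count-⋃≤ {W = U∖⁅ v ⁆} {S = A} c
                              (λ u u∈ → ∣A∣≤c u (Vecₚ.lookup⇒[]= u U (Boolₚ.∧-conicalˡ _ _ u∈))) ⟩
    c * count U∖⁅ v ⁆    ≤⟨ *-monoʳ-≤ c (count-mono (λ u → Boolₚ.∧-conicalˡ (lookup U u) _)) ⟩
    c * count (lookup U) ≡⟨ cong (c *_) (sym (∣p∣≡count U)) ⟩
    c * ∣ U ∣            ∎
    where open ≤-Reasoning

  Uncovered : (Fin n → Fin n → Bool) → Fin n → Set
  Uncovered A z = ∀ u → u ∈ U → A u z ≡ false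

  covered : (Fin n → Fin n → Bool) → Fin n → Bool
  covered = ⋃ (lookup U)

  _∖covered_ : (Fin n → Bool) → (Fin n → Fin n → Bool) → Fin n → Bool
  (E ∖covered A) z = E z ∧ not (covered A z)

  ∖covered-⊆ : ∀ E A → (E ∖covered A) ⊆ᵇ E
  ∖covered-⊆ E A z = Boolₚ.∧-conicalˡ (E z) _

  ∉∖covered : ∀ E A {u x} → u ∈ U → A u x ≡ true → (E ∖covered A) x ≡ false
  ∉∖covered E A {x = x} u∈U Aux
    rewrite ∈⋃⁺ {W = lookup U} {S = A} (Vecₚ.[]=⇒lookup u∈U) Aux = Boolₚ.∧-zeroʳ (E x)

  ∉∖covered⇒∉ : ∀ E A {z} → Uncovered A z → (E ∖covered A) z ≡ false → E z ≡ false
  ∉∖covered⇒∉ E A {z} z∉A z∉E∖A =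
    trans (sym (Boolₚ.∧-identityʳ (E z))) (subst (λ b → E z ∧ not b ≡ false) z∉covered z∉E∖A)
    where
    z∉covered : covered A z ≡ false
    z∉covered = Boolₚ.¬-not λ z∈ →
      let (u , u∈U , Auz) = ∈⋃⁻ {W = lookup U} {S = A} z∈ in
      true⇒¬false Auz (z∉A u (Vecₚ.lookup⇒[]= u U u∈U))

  record Settled (A : Fin n → Fin n → Bool) (E : Fin n → Bool) (u : Fin n) : Set where
    field
      dominates    : ∀ z → E z ≡ false → Uncovered A z → ∃ λ a → A u a ≡ true × Edge T a z
      transitive   : TransitiveWithHeadᵇ T (A u) u
      exceptional≤ : 2 ^ (c ∸ 1) * count E ≤ indeg T u
      2≤∣A∣        : 2 ≤ count (A u)

  settled-mono : ∀ {A A′ E u} → A′ u ≡ A u → (∀ z → Uncovered A′ z → Uncovered A z) →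
    Settled A E u → Settled A′ E u
  settled-mono {E = E} {u} A′u≡Au uncovered S = record
    { dominates    = λ z z∉E z∉A′ → subst (λ B → ∃ λ a → B a ≡ true × Edge T a z) (sym A′u≡Au)
                                          (dominates z z∉E (uncovered z z∉A′))
    ; transitive   = subst (λ B → TransitiveWithHeadᵇ T B u) (sym A′u≡Au) transitive
    ; exceptional≤ = exceptional≤
    ; 2≤∣A∣        = subst (λ B → 2 ≤ count B) (sym A′u≡Au) 2≤∣A∣
    }
    where open Settled S

  record PartialAssignment (k : ℕ) : Set where
    field
      A E      : Fin n → Fin n → Bool
      head∈    : ∀ u → u ∈ U → A u u ≡ true
      disjoint : ∀ u u′ → u ∈ U → u′ ∈ U → u ≢ u′ → ∀ x → A u x ≡ true → A u′ x ≡ false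
      ∣A∣≤c    : ∀ u → u ∈ U → count (A u) ≤ c
      pending  : ∀ u → u ∈ U → k ≤ toℕ u → ∀ x → A u x ≡ true → x ≡ u
      settled  : ∀ u → u ∈ U → toℕ u < k → Settled A (E u) u

  emptyAssignment : 1 ≤ c → PartialAssignment 0
  emptyAssignment 1≤c = record
    { A        = ⁅_⁆
    ; E        = λ _ _ → false
    ; head∈    = λ u _ → ∈-insert⁺ˡ u _
    ; disjoint = λ u u′ _ _ u≢u′ x x∈u → Boolₚ.¬-not λ x∈u′ →
                   u≢u′ (trans (sym (∈⁅⁆⁻ {y = x} x∈u)) (∈⁅⁆⁻ {y = x} x∈u′))
    ; ∣A∣≤c    = λ u _ → subst (_≤ c) (sym (count-⁅⁆ u)) 1≤c
    ; pending  = λ u _ _ x → ∈⁅⁆⁻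
    ; settled  = λ _ _ ()
    }

  skipVertex : ∀ {k} → PartialAssignment k → ∀ v → toℕ v ≡ k → v ∉ U → PartialAssignment (suc k)
  skipVertex P v v≡k v∉U = record
    { A        = A
    ; E        = E
    ; head∈    = head∈
    ; disjoint = disjoint
    ; ∣A∣≤c    = ∣A∣≤c
    ; pending  = λ u u∈U k<u → pending u u∈U (<⇒≤ k<u)
    ; settled  = settled′
    }
    where
    open PartialAssignment P
    settled′ : ∀ u → u ∈ U → toℕ u < suc _ → Settled A (E u) u
    settled′ u u∈U u≤k with m≤n⇒m<n∨m≡n (s≤s⁻¹ u≤k)
    ... | inj₁ u<k = settled u u∈U u<k
    ... | inj₂ u≡k = contradiction (subst (_∈ U) (Finₚ.toℕ-injective (trans u≡k (sym v≡k))) u∈U) v∉U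

  others-excludes-head : ∀ {k} (P : PartialAssignment k) v → v ∈ U →
    others (PartialAssignment.A P) v v ≡ false
  others-excludes-head P v v∈U = Boolₚ.¬-not λ v∈others →
    let (u , u∈U , u≢v , Auv) = ∈others⁻ A v∈others in
    true⇒¬false (head∈ v v∈U) (disjoint u v u∈U v∈U u≢v v Auv)
    where open PartialAssignment P

  assignVertex : ∀ {k} (P : PartialAssignment k) v → toℕ v ≡ k → v ∈ U →
    Dominator T (others (PartialAssignment.A P) v) v c → PartialAssignment (suc k)
  assignVertex {k} P v v≡k v∈U D = record
    { A        = A′
    ; E        = E′
    ; head∈    = head∈′
    ; disjoint = disjoint′
    ; ∣A∣≤c    = ∣A∣≤c′
    ; pending  = pending′
    ; settled  = settled′
    }
    where
    open PartialAssignment P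
    module D = Dominator D
    A′ E′ : Fin n → Fin n → Bool
    A′ = updateAt A v (λ _ → D.A)
    E′ = updateAt E v (λ _ → D.E)
    A′v : A′ v ≡ D.A
    A′v = updateAt-updates v A
    A′u : ∀ {u} → u ≢ v → A′ u ≡ A u
    A′u u≢v = updateAt-minimal _ v A u≢v
    v∈D : D.A v ≡ true
    v∈D = transitive⇒head∈ {T = T} D.transitive
    uncovered⇒∉D : ∀ z → Uncovered A′ z → D.A z ≡ false
    uncovered⇒∉D z z∉A′ = subst (λ B → B z ≡ false) A′v (z∉A′ v v∈U)
    old-vs-new : ∀ {u x} → u ∈ U → u ≢ v → A u x ≡ true → ¬ (D.A x ≡ true)
    old-vs-new u∈U u≢v Aux D∋x = true⇒¬false (∈others⁺ A u∈U u≢v Aux) (D.avoids _ D∋x)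

    head∈′ : ∀ u → u ∈ U → A′ u u ≡ true
    head∈′ u u∈U with u Fin.≟ v
    ... | yes refl rewrite A′v = v∈D
    ... | no u≢v rewrite A′u u≢v = head∈ u u∈U

    disjoint′ : ∀ u u′ → u ∈ U → u′ ∈ U → u ≢ u′ → ∀ x → A′ u x ≡ true → A′ u′ x ≡ false
    disjoint′ u u′ u∈U u′∈U u≢u′ x with u Fin.≟ v | u′ Fin.≟ v
    ... | yes refl | yes refl = contradiction refl u≢u′
    ... | yes refl | no u′≢v rewrite A′v | A′u u′≢v =
      λ D∋x → Boolₚ.¬-not λ Au′x → old-vs-new u′∈U u′≢v Au′x D∋x
    ... | no u≢v | yes refl rewrite A′v | A′u u≢v =
      λ Aux → Boolₚ.¬-not (old-vs-new u∈U u≢v Aux)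
    ... | no u≢v | no u′≢v rewrite A′u u≢v | A′u u′≢v = disjoint u u′ u∈U u′∈U u≢u′ x

    ∣A∣≤c′ : ∀ u → u ∈ U → count (A′ u) ≤ c
    ∣A∣≤c′ u u∈U with u Fin.≟ v
    ... | yes refl rewrite A′v = D.∣A∣≤c
    ... | no u≢v rewrite A′u u≢v = ∣A∣≤c u u∈U

    pending′ : ∀ u → u ∈ U → suc k ≤ toℕ u → ∀ x → A′ u x ≡ true → x ≡ u
    pending′ u u∈U k<u with u Fin.≟ v
    ... | yes refl = contradiction k<u (<-irrefl (sym v≡k))
    ... | no u≢v rewrite A′u u≢v = pending u u∈U (<⇒≤ k<u)

    uncovered′ : ∀ z → Uncovered A′ z → Uncovered A z
    uncovered′ z z∉A′ u u∈U with u Fin.≟ v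
    ... | no u≢v = subst (λ B → B z ≡ false) (A′u u≢v) (z∉A′ u u∈U)
    -- before this step A v ⊆ {v}, and v lies in the new A v
    ... | yes refl = Boolₚ.¬-not λ Avz →
      true⇒¬false (subst (λ y → D.A y ≡ true) (sym (pending v v∈U (≤-reflexive (sym v≡k)) z Avz)) v∈D)
                  (uncovered⇒∉D z z∉A′)

    settledHere : Settled A′ (E′ v) v
    settledHere = subst (λ X → Settled A′ X v) (sym (updateAt-updates v E)) record
      { dominates    = λ z z∉E z∉A′ → subst (λ B → ∃ λ a → B a ≡ true × Edge T a z) (sym A′v)
                                            (D.dominates z (uncovered⇒∉D z z∉A′)
                                                           (z∉others z z∉A′) z∉E)
      ; transitive   = subst (λ B → TransitiveWithHeadᵇ T B v) (sym A′v) D.transitive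
      ; exceptional≤ = D.exceptional≤
      ; 2≤∣A∣        = subst (λ B → 2 ≤ count B) (sym A′v) D.2≤∣A∣
      }
      where
      z∉others : ∀ z → Uncovered A′ z → others A v z ≡ false
      z∉others z z∉A′ = Boolₚ.¬-not λ z∈others →
        let (u , u∈U , u≢v , Auz) = ∈others⁻ A z∈others in
        true⇒¬false Auz (uncovered′ z z∉A′ u u∈U)

    settled′ : ∀ u → u ∈ U → toℕ u < suc k → Settled A′ (E′ u) u
    settled′ u u∈U u≤k with u Fin.≟ v
    ... | yes refl = settledHere
    ... | no u≢v with m≤n⇒m<n∨m≡n (s≤s⁻¹ u≤k)
    ...   | inj₂ u≡k = contradiction (Finₚ.toℕ-injective (trans u≡k (sym v≡k))) u≢v
    ...   | inj₁ u<k = subst (λ X → Settled A′ X u) (sym (updateAt-minimal u v E u≢v))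
                              (settled-mono (A′u u≢v) uncovered′ (settled u u∈U u<k))

  module _ (2≤c : 2 ≤ c) (large : minIndeg≥ T (2 ^ (c + 1) + c * ∣ U ∣)) where

    others<indeg : ∀ {k} (P : PartialAssignment k) v → count (others (PartialAssignment.A P) v) < indeg T v
    others<indeg P v = begin-strict
      count (others A v)      ≤⟨ count-others≤ v ∣A∣≤c ⟩
      c * ∣ U ∣               <⟨ m<n+m (c * ∣ U ∣) (m^n>0 2 (c + 1)) ⟩
      2 ^ (c + 1) + c * ∣ U ∣ ≤⟨ large v ⟩
      indeg T v               ∎
      where
      open PartialAssignment P
      open ≤-Reasoning

    nextAssignment : ∀ {k} → PartialAssignment k → ∀ v → toℕ v ≡ k → PartialAssignment (suc k)
    nextAssignment P v v≡k with v ∈? U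
    ... | no  v∉U = skipVertex P v v≡k v∉U
    ... | yes v∈U = assignVertex P v v≡k v∈U
      (dominator T (others (PartialAssignment.A P) v) v c 2≤c (others-excludes-head P v v∈U) (others<indeg P v))

    assignUpTo : ∀ k → k ≤ n → PartialAssignment k
    assignUpTo zero    _   = emptyAssignment (<⇒≤ 2≤c)
    assignUpTo (suc k) k<n = nextAssignment (assignUpTo k (<⇒≤ k<n)) (fromℕ< k<n) (Finₚ.toℕ-fromℕ< k<n)

lemma8p5 : (n : ℕ) (T : Tournament n) (U : Subset n) (c : ℕ) → 2 ≤ c →
    minIndeg≥ T (2 ^ (c + 1) + c * ∣ U ∣) →
    Σ (Fin n → Subset n) λ A → Σ (Fin n → Subset n) λ E →
      (∀ v → v ∈ U →
        OutDominates T (A v) (λ z → z ∉ E v × (∀ u → u ∈ U → z ∉ A u))) ×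
      (∀ v → v ∈ U → TransitiveWithHead T (A v) v) ×
      (∀ v → v ∈ U → 2 ^ (c ∸ 1) * ∣ E v ∣ ≤ indeg T v) ×
      (∀ v → v ∈ U → 2 ≤ ∣ A v ∣ × ∣ A v ∣ ≤ c) ×
      (∀ u v → u ∈ U → v ∈ U → ∀ x → x ∈ A u → x ∉ E v) ×
      (∀ u v → u ∈ U → v ∈ U → u ≢ v → ∀ x → x ∈ A u → x ∉ A v)
lemma8p5 n T U c 2≤c large =
  (λ v → tabulate (A v)) , (λ v → tabulate (E′ v)) ,
  (λ v v∈U z (z∉E′ , z∉A) → dominated v v∈U z (∉-tabulate⁻ z∉E′) (λ u u∈U → ∉-tabulate⁻ (z∉A u u∈U))) ,
  (λ v v∈U → transitiveWithHead-tabulate {T = T} (Settled.transitive (settledAt v v∈U))) ,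
  (λ v v∈U → subst (λ m → 2 ^ (c ∸ 1) * m ≤ indeg T v) (sym (∣tabulate∣ (E′ v)))
    (≤-trans (*-monoʳ-≤ (2 ^ (c ∸ 1)) (count-mono (∖covered-⊆ T U c (E v) A)))
             (Settled.exceptional≤ (settledAt v v∈U)))) ,
  (λ v v∈U → subst (λ m → 2 ≤ m × m ≤ c) (sym (∣tabulate∣ (A v)))
    (Settled.2≤∣A∣ (settledAt v v∈U) , ∣A∣≤c v v∈U)) ,
  (λ u v u∈U v∈U x x∈Au x∈E′ →
    true⇒¬false (∈-tabulate⁻ x∈E′) (∉∖covered T U c (E v) A u∈U (∈-tabulate⁻ x∈Au))) ,
  (λ u v u∈U v∈U u≢v x x∈Au x∈Av →
    true⇒¬false (∈-tabulate⁻ x∈Av) (disjoint u v u∈U v∈U u≢v x (∈-tabulate⁻ x∈Au)))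
  where
  open PartialAssignment (assignUpTo T U c 2≤c large n ≤-refl)
  E′ : Fin n → Fin n → Bool
  E′ v = _∖covered_ T U c (E v) A
  settledAt : ∀ v → v ∈ U → Settled T U c A (E v) v
  settledAt v v∈U = settled v v∈U (Finₚ.toℕ<n v)
  dominated : ∀ v → v ∈ U → ∀ z → E′ v z ≡ false → Uncovered T U c A z →
    ∃ λ a → a ∈ tabulate (A v) × Edge T a z
  dominated v v∈U z z∉E′ z∉A
    with (a , a∈Av , a→z) ← Settled.dominates (settledAt v v∈U) z (∉∖covered⇒∉ T U c (E v) A z∉A z∉E′) z∉A
    = a , ∈-tabulate⁺ a∈Av , a→z
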